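{- Let $G$ be a Stopping Game with $n$ nodes, given together with, for each node, the list of its parents (nodes with an arc into it). The Find 1-Valued Nodes procedure described in the context runs in $O(n)$ time, and the set of nodes it returns is exactly the set of nodes of $G$ whose value in the unique stable assignment of $G$ equals $1$.
   Context: A simple stochastic game (SSG) is a finite directed graph whose nodes are numbered $1,\dots,n$ and are of four types: max, min, average and terminal, with exactly two terminal nodes, terminal-0 (numbered $n-1$) and terminal-1 (numbered $n$), having no out-arcs, and every max, min and average node having exactly two out-arcs. A stable assignment is an assignment of values $v_i\in[0,1]$ with $v_{n-1}=0$, $v_n=1$, $v_i=\max(v_j,v_k)$ for each max node $i$ with children $j,k$, $v_i=\min(v_j,v_k)$ for each min node $i$ with children $j,k$, and $v_i=(v_j+v_k)/2$ for each average node $i$ with children $j,k$. For a max strategy $\sigma$ (choice of one out-arc at each max node) and min strategy $\tau$ (one out-arc at each min node), $G_{\sigma,\tau}$ keeps only the chosen arcs at max/min nodes and both arcs at average nodes. $G$ is a Stopping Game if for every $(\sigma,\tau)$ and every node $v$ there is a path in $G_{\sigma,\tau}$ from $v$ to a terminal; a Stopping Game has exactly one stable assignment, and the value of a node means its value in it. Find 1-Valued Nodes: Initialize a queue $q$ containing only terminal-0 and an array $bv$ of length $n$ with all entries $1$ except $bv[n-1]=0$. While $q$ is nonempty: pop a node $u$ from $q$; for each parent $p$ of $u$ (with index $i$), if $bv[i]=1$ then: if $p$ is a min or average node, set $bv[i]=0$ and add $p$ to $q$; if $p$ is a max node whose two children $a,b$ satisfy $bv[a]=bv[b]=0$, set $bv[i]=0$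 and add $p$ to $q$. Finally return the set of nodes $i$ with $bv[i]=1$.
   Formalization: Stable assignments take rational values in [0,1] instead of real ones. -}

module Defs where

open import Data.Nat as ℕ using (ℕ; zero; suc)
open import Data.Fin using (Fin; fromℕ; inject₁; _≟_)
open import Data.Bool using (Bool; true; false; if_then_else_; not; _∧_)
open import Data.List using (List; []; _∷_; _++_; [_]; length; foldl)
open import Data.List.Membership.Propositional using (_∈_)
open import Data.List.Relation.Unary.Unique.Propositional using (Unique)
open import Data.Rational using (ℚ; 0ℚ; 1ℚ; ½; _⊔_; _⊓_; _+_; _*_; _≤_)
open import Data.Product using (_×_; _,_)
open import Data.Sum using (_⊎_)
open import Relation.Nullary.Decidable using (⌊_⌋)
open import Relation.Binary.PropositionalEquality using (_≡_)
open import Relation.Binary.Construct.Closure.ReflexiveTransitive using (Star)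
open import Function.Bundles using (_⇔_)

-- Node types.  Nodes are Fin n (0-based: paper node i is Fin index i-1).
data NodeType : Set where
  maxN minN avgN term0 term1 : NodeType

record SSG (m : ℕ) : Set where
  field
    type   : Fin (suc (suc m)) → NodeType
    child₁ : Fin (suc (suc m)) → Fin (suc (suc m))
    child₂ : Fin (suc (suc m)) → Fin (suc (suc m))
    parents : Fin (suc (suc m)) → List (Fin (suc (suc m)))

module _ {m : ℕ} where

  Node : Set
  Node = Fin (suc (suc m))

  -- terminal-0 is paper node n-1 (Fin index m), terminal-1 is paper node n (Fin index m+1)
  t0 : Node
  t0 = inject₁ (fromℕ m)

  t1 : Node
  t1 = fromℕ (suc m)

  IsTerminal : NodeType → Set
  IsTerminal t = (t ≡ term0) ⊎ (t ≡ term1)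

  IsNonTerminal : NodeType → Set
  IsNonTerminal t = (t ≡ maxN) ⊎ (t ≡ minN) ⊎ (t ≡ avgN)

  record WellFormed (G : SSG m) : Set where
    open SSG G
    field
      term0-iff : ∀ i → type i ≡ term0 ⇔ i ≡ t0
      term1-iff : ∀ i → type i ≡ term1 ⇔ i ≡ t1
      parents-unique : ∀ u → Unique (parents u)
      parents-correct : ∀ u p → p ∈ parents u ⇔
                          (IsNonTerminal (type p) × ((child₁ p ≡ u) ⊎ (child₂ p ≡ u)))

  -- Strategies: at each node, true = take child₁, false = take child₂
  -- (only consulted at max nodes for σ, at min nodes for τ).
  Strategy : Set
  Strategy = Node → Bool

  choose : SSG m → Bool → Node → Node
  choose G b i = if b then SSG.child₁ G i else SSG.child₂ G i

  data Arc (G : SSG m) (σ τ : Strategy) : Node → Node → Set where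
    maxArc : ∀ {i} → SSG.type G i ≡ maxN → Arc G σ τ i (choose G (σ i) i)
    minArc : ∀ {i} → SSG.type G i ≡ minN → Arc G σ τ i (choose G (τ i) i)
    avgArc₁ : ∀ {i} → SSG.type G i ≡ avgN → Arc G σ τ i (SSG.child₁ G i)
    avgArc₂ : ∀ {i} → SSG.type G i ≡ avgN → Arc G σ τ i (SSG.child₂ G i)

  data ReachesTerminal (G : SSG m) (σ τ : Strategy) (v : Node) : Set where
    reach : ∀ {w} → Star (Arc G σ τ) v w → IsTerminal (SSG.type G w) → ReachesTerminal G σ τ v

  StoppingGame : SSG m → Set
  StoppingGame G = ∀ (σ τ : Strategy) (v : Node) → ReachesTerminal G σ τ v

  record Stable (G : SSG m) (v : Node → ℚ) : Set where
    open SSG G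
    field
      range : ∀ i → (0ℚ ≤ v i) × (v i ≤ 1ℚ)
      val-t0 : v t0 ≡ 0ℚ
      val-t1 : v t1 ≡ 1ℚ
      val-max : ∀ i → type i ≡ maxN → v i ≡ v (child₁ i) ⊔ v (child₂ i)
      val-min : ∀ i → type i ≡ minN → v i ≡ v (child₁ i) ⊓ v (child₂ i)
      val-avg : ∀ i → type i ≡ avgN → v i ≡ (v (child₁ i) + v (child₂ i)) * ½

  -- The Find 1-Valued Nodes procedure, with an explicit cost counter.
  -- bv i = true means bv[i] = 1.

  record AlgState : Set where
    constructor ⟨_,_,_⟩
    field
      queue : List Node
      bv    : Node → Bool
      cost  : ℕ

  setFalse : (Node → Bool) → Node → (Node → Bool)
  setFalse bv i j = if ⌊ j ≟ i ⌋ then false else bv j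

  processParent : SSG m → (List Node × (Node → Bool)) → Node → (List Node × (Node → Bool))
  processParent G (q , bv) p with bv p | SSG.type G p
  ... | false | _    = (q , bv)
  ... | true  | minN = (q ++ [ p ] , setFalse bv p)
  ... | true  | avgN = (q ++ [ p ] , setFalse bv p)
  ... | true  | maxN =
        if not (bv (SSG.child₁ G p)) ∧ not (bv (SSG.child₂ G p))
        then (q ++ [ p ] , setFalse bv p)
        else (q , bv)
  ... | true  | term0 = (q , bv)
  ... | true  | term1 = (q , bv)

  -- one iteration of the while loop; cost = 1 (pop) + one unit per parent examined
  step : SSG m → AlgState → AlgState
  step G ⟨ [] , bv , c ⟩ = ⟨ [] , bv , c ⟩
  step G ⟨ u ∷ q , bv , c ⟩ with foldl (processParent G) (q , bv) (SSG.parents G u)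
  ... | (q' , bv') = ⟨ q' , bv' , c ℕ.+ suc (length (SSG.parents G u)) ⟩

  -- initialisation costs n = 2 + m (filling the array bv)
  initState : AlgState
  initState = ⟨ [ t0 ] , (λ j → not ⌊ j ≟ t0 ⌋) , suc (suc m) ⟩

  iterateSteps : SSG m → ℕ → AlgState
  iterateSteps G zero = initState
  iterateSteps G (suc k) = step G (iterateSteps G k)

{-# OPTIONS --safe #-}
module Submission where

-- The procedure unmarks (sets bv to 0) only nodes that are not 1-valued: min and average
-- nodes with a child already known to be below 1, and max nodes both of whose children are.
-- Moreover, every marked node stays closed in the set of live (marked or queued) nodes:
-- a marked max node has a live child, a marked min or average node has both children live.
-- Each iteration removes the popped node from the live set for good, which bounds the number
-- of iterations by n and the cost by n + Σᵤ (1 + |parents u|) ≤ 4n, since each node is a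
-- parent at most twice.
-- Once the queue is empty, the marked set S is closed and misses terminal-0. If μ is the
-- least value on S, the nodes of S of value μ form a trap that both players can stay in
-- (an average node of value μ whose children have values ≥ μ has both children of value μ).
-- As the game is stopping, a play inside the trap reaches a terminal, which must be
-- terminal-1; hence μ = 1.

open import Defs
open import Data.Nat using (ℕ; zero; suc)
open import Data.Fin using (Fin)
open import Data.Bool using (Bool; true; false)
import Data.Bool as Bool
open import Data.Bool.Properties using (not-¬; ¬-not)
open import Data.List using (List; []; _∷_; _++_; [_]; filter; allFin; foldl; length)
open import Data.List.Membership.Propositional using (_∈_; _∉_)
open import Data.List.Membership.Propositional.Properties
  using (∈-filter⁺; ∈-allFin; ∈-++⁺ˡ; ∈-++⁺ʳ; ∈-++⁻)
import Data.List.Membership.DecPropositional as DecMembership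
open import Data.List.Relation.Unary.Any using (here; there)
open import Data.List.Relation.Unary.All using ([]; lookup)
open import Data.List.Relation.Unary.All.Properties using (All¬⇒¬Any; all-filter)
open import Data.List.Relation.Unary.Unique.Propositional using (Unique; []; _∷_)
open import Data.List.Relation.Unary.Unique.Propositional.Properties using (++⁺)
import Data.List.Extrema
open import Data.Rational using (ℚ; 1ℚ; ½)
open import Data.Product using (Σ; ∃-syntax; _×_; _,_; proj₁; proj₂)
open import Data.Sum using (_⊎_; inj₁; inj₂; [_,_]′)
open import Data.Unit using (⊤; tt)
open import Data.Empty using (⊥)
open import Function using (_∘_; id; flip; const)
open import Function.Bundles using (Equivalence; _⇔_; mk⇔)
open import Relation.Binary.Bundles using (DecTotalOrder)
import Relation.Binary.Construct.Closure.ReflexiveTransitive as Star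
open import Relation.Nullary using (¬_; Dec; yes; no; does; contradiction)
open import Relation.Nullary.Decidable using (_×-dec_; _⊎-dec_)
open import Relation.Unary using (Pred; Decidable; Universal; _⊆_; _≐_)
open import Relation.Binary.PropositionalEquality
  using (_≡_; refl; sym; trans; cong; cong₂; subst; module ≡-Reasoning)

module _ where
  open import Data.Rational using (_+_; _*_; _≤_)
  open import Data.Rational.Properties
    using ( ≤-decTotalOrder; ≤-antisym; ≮⇒≥; <-irrefl; *-monoˡ-<-pos; +-mono-<-≤; +-comm
          ; *-distribʳ-+; *-distribˡ-+; *-identityʳ)

  -- The middle step uses that ½ + ½ evaluates to 1ℚ.
  mean-self : ∀ a → (a + a) * ½ ≡ a
  mean-self a = begin
    (a + a) * ½        ≡⟨ *-distribʳ-+ ½ a a ⟩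
    a * ½ + a * ½      ≡⟨ *-distribˡ-+ a ½ ½ ⟨
    a * 1ℚ             ≡⟨ *-identityʳ a ⟩
    a                  ∎
    where open ≡-Reasoning

  mean≡-lower : ∀ {a x y} → a ≤ x → a ≤ y → (x + y) * ½ ≡ a → x ≡ a × y ≡ a
  mean≡-lower {a} {x} {y} a≤x a≤y mean≡a =
    at-bound a≤x a≤y mean≡a , at-bound a≤y a≤x (trans (cong (_* ½) (+-comm y x)) mean≡a)
    where
    at-bound : ∀ {x y} → a ≤ x → a ≤ y → (x + y) * ½ ≡ a → x ≡ a
    at-bound {x} {y} a≤x a≤y mean≡a = ≤-antisym (≮⇒≥ λ a<x →
      <-irrefl (trans (mean-self a) (sym mean≡a)) (*-monoˡ-<-pos ½ (+-mono-<-≤ a<x a≤y))) a≤x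

  mean≡-upper : ∀ {a x y} → x ≤ a → y ≤ a → (x + y) * ½ ≡ a → x ≡ a × y ≡ a
  mean≡-upper {a} {x} {y} x≤a y≤a mean≡a =
    at-bound x≤a y≤a mean≡a , at-bound y≤a x≤a (trans (cong (_* ½) (+-comm y x)) mean≡a)
    where
    at-bound : ∀ {x y} → x ≤ a → y ≤ a → (x + y) * ½ ≡ a → x ≡ a
    at-bound {x} {y} x≤a y≤a mean≡a = ≤-antisym x≤a (≮⇒≥ λ x<a →
      <-irrefl (trans mean≡a (sym (mean-self a))) (*-monoˡ-<-pos ½ (+-mono-<-≤ x<a y≤a)))

  minimiser : ∀ {n ℓ} (f : Fin n → ℚ) {S : Pred (Fin n) ℓ} → Decidable S → ∀ {i} → S i →
              ∃[ j ] S j × (∀ {k} → S k → f j ≤ f k)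
  minimiser {n} f S? {i} Si =
    argmin f i candidates ,
    argmin-all f Si (all-filter S? (allFin n)) ,
    λ Sk → lookup (f[argmin]≤f[xs] i candidates) (∈-filter⁺ S? (∈-allFin _) Sk)
    where
    open Data.List.Extrema (DecTotalOrder.totalOrder ≤-decTotalOrder)
      using (argmin; argmin-all; f[argmin]≤f[xs])
    candidates : List (Fin n)
    candidates = filter S? (allFin n)

module _ {m : ℕ} (G : SSG m) where
  open SSG G
  open import Data.Rational using (_≤_)
  open import Data.Rational.Properties using (_≟_; ≤-antisym; ⊔-sel; ⊓-sel; p≤p⊔q; p≤q⊔p; p⊓q≤p; p⊓q≤q)

  Closed : NodeType → (Node {m} → Set) → Node {m} → Set
  Closed maxN  S p = S (child₁ p) ⊎ S (child₂ p)
  Closed minN  S p = S (child₁ p) × S (child₂ p)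
  Closed avgN  S p = S (child₁ p) × S (child₂ p)
  Closed term0 S p = ⊤
  Closed term1 S p = ⊤

  IsClosed : (Node {m} → Set) → Set
  IsClosed S = ∀ {p} → S p → Closed (type p) S p

  Closed-mono : ∀ t {S T : Node {m} → Set} {p} →
                (IsNonTerminal {m} t → ∀ {c} → child₁ p ≡ c ⊎ child₂ p ≡ c → S c → T c) →
                Closed t S p → Closed t T p
  Closed-mono maxN  S⇒T (inj₁ S₁)  = inj₁ (S⇒T (inj₁ refl) (inj₁ refl) S₁)
  Closed-mono maxN  S⇒T (inj₂ S₂)  = inj₂ (S⇒T (inj₁ refl) (inj₂ refl) S₂)
  Closed-mono minN  S⇒T (S₁ , S₂)  =
    S⇒T (inj₂ (inj₁ refl)) (inj₁ refl) S₁ , S⇒T (inj₂ (inj₁ refl)) (inj₂ refl) S₂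
  Closed-mono avgN  S⇒T (S₁ , S₂)  =
    S⇒T (inj₂ (inj₂ refl)) (inj₁ refl) S₁ , S⇒T (inj₂ (inj₂ refl)) (inj₂ refl) S₂
  Closed-mono term0 _   _          = tt
  Closed-mono term1 _   _          = tt

  Closed-universal : ∀ t {S : Node {m} → Set} {p} → Universal S → Closed t S p
  Closed-universal maxN  all = inj₁ (all _)
  Closed-universal minN  all = all _ , all _
  Closed-universal avgN  all = all _ , all _
  Closed-universal term0 all = tt
  Closed-universal term1 all = tt

  Trap : NodeType → (Node {m} → Set) → Node {m} → Set
  Trap maxN  S p = S (child₁ p) ⊎ S (child₂ p)
  Trap minN  S p = S (child₁ p) ⊎ S (child₂ p)
  Trap avgN  S p = S (child₁ p) × S (child₂ p)
  Trap term0 S p = ⊤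
  Trap term1 S p = ⊤

  IsTrap : (Node {m} → Set) → Set
  IsTrap S = ∀ {p} → S p → Trap (type p) S p

  module _ {v : Node {m} → ℚ} (stable : Stable G v) where
    open Stable stable

    one-valued-closed : IsClosed (λ c → v c ≡ 1ℚ)
    one-valued-closed {p} vp≡1 = closed (type p) refl
      where
      v₁ v₂ : ℚ
      v₁ = v (child₁ p)
      v₂ = v (child₂ p)
      one : ∀ {x} → v p ≡ x → x ≡ 1ℚ
      one vp≡x = trans (sym vp≡x) vp≡1
      closed : ∀ t → type p ≡ t → Closed t (λ c → v c ≡ 1ℚ) p
      closed maxN type≡ with ⊔-sel v₁ v₂
      ... | inj₁ ⊔≡v₁ = inj₁ (trans (sym ⊔≡v₁) (one (val-max p type≡)))
      ... | inj₂ ⊔≡v₂ = inj₂ (trans (sym ⊔≡v₂) (one (val-max p type≡)))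
      closed minN type≡ =
        ≤-antisym (proj₂ (range _)) (subst (_≤ v₁) (one (val-min p type≡)) (p⊓q≤p v₁ v₂)) ,
        ≤-antisym (proj₂ (range _)) (subst (_≤ v₂) (one (val-min p type≡)) (p⊓q≤q v₁ v₂))
      closed avgN type≡ = mean≡-upper (proj₂ (range _)) (proj₂ (range _)) (one (val-avg p type≡))
      closed term0 _ = tt
      closed term1 _ = tt

    level-set-trap : ∀ {S} → IsClosed S → ∀ {μ} → (∀ {k} → S k → μ ≤ v k) →
                     IsTrap (λ k → S k × v k ≡ μ)
    level-set-trap {S} closed {μ} μ≤ {p} (Sp , vp≡μ) = trap (type p) refl (closed Sp)
      where
      v₁ v₂ : ℚ
      v₁ = v (child₁ p)
      v₂ = v (child₂ p)
      at-μ : ∀ {x} → v p ≡ x → x ≡ μ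
      at-μ vp≡x = trans (sym vp≡x) vp≡μ
      squeeze : ∀ {c} → S c → v c ≤ μ → S c × v c ≡ μ
      squeeze Sc vc≤μ = Sc , ≤-antisym vc≤μ (μ≤ Sc)
      trap : ∀ t → type p ≡ t → Closed t S p → Trap t (λ k → S k × v k ≡ μ) p
      trap maxN type≡ (inj₁ Sc₁) =
        inj₁ (squeeze Sc₁ (subst (v₁ ≤_) (at-μ (val-max p type≡)) (p≤p⊔q v₁ v₂)))
      trap maxN type≡ (inj₂ Sc₂) =
        inj₂ (squeeze Sc₂ (subst (v₂ ≤_) (at-μ (val-max p type≡)) (p≤q⊔p v₁ v₂)))
      trap minN type≡ (Sc₁ , Sc₂) with ⊓-sel v₁ v₂
      ... | inj₁ ⊓≡v₁ = inj₁ (Sc₁ , trans (sym ⊓≡v₁) (at-μ (val-min p type≡)))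
      ... | inj₂ ⊓≡v₂ = inj₂ (Sc₂ , trans (sym ⊓≡v₂) (at-μ (val-min p type≡)))
      trap avgN type≡ (Sc₁ , Sc₂) =
        let v₁≡μ , v₂≡μ = mean≡-lower (μ≤ Sc₁) (μ≤ Sc₂) (at-μ (val-avg p type≡))
        in (Sc₁ , v₁≡μ) , (Sc₂ , v₂≡μ)
      trap term0 _ _ = tt
      trap term1 _ _ = tt

  module _ {M : Node {m} → Set} (M? : Decidable M) (trap : IsTrap M) where

    stay : Strategy
    stay k = does (M? (child₁ k))

    stay-in-child : ∀ k → M (child₁ k) ⊎ M (child₂ k) → M (choose G (stay k) k)
    stay-in-child k M-child with M? (child₁ k)
    ... | yes Mc₁ = Mc₁
    ... | no ¬Mc₁ = [ flip contradiction ¬Mc₁ , id ]′ M-child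

    stay-along-arc : ∀ {k w} → Arc G stay stay k w → M k → M w
    stay-along-arc {k} (maxArc type≡) Mk = stay-in-child k (subst (λ t → Trap t M k) type≡ (trap Mk))
    stay-along-arc {k} (minArc type≡) Mk = stay-in-child k (subst (λ t → Trap t M k) type≡ (trap Mk))
    stay-along-arc {k} (avgArc₁ type≡) Mk = proj₁ (subst (λ t → Trap t M k) type≡ (trap Mk))
    stay-along-arc {k} (avgArc₂ type≡) Mk = proj₂ (subst (λ t → Trap t M k) type≡ (trap Mk))

    trap-meets-terminal : StoppingGame G → ∀ {j} → M j → ∃[ w ] M w × IsTerminal {m} (type w)
    trap-meets-terminal stop {j} Mj with stop stay stay j
    ... | reach path terminal =
      _ , Star.fold (λ k w → M k → M w) (λ arc stays → stays ∘ stay-along-arc arc) id path Mj , terminal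

  closed⇒one-valued : WellFormed G → StoppingGame G → ∀ {v} → Stable G v →
                      ∀ {S} → Decidable S → IsClosed S → ¬ S t0 → ∀ {i} → S i → v i ≡ 1ℚ
  closed⇒one-valued wf stop {v} stable {S} S? closed ¬St0 {i} Si with minimiser v S? Si
  ... | j , Sj , j-min = ≤-antisym (proj₂ (range i)) (subst (_≤ v i) minimum≡1 (j-min Si))
    where
    open Stable stable
    open WellFormed wf using (term0-iff; term1-iff)
    Level : Node {m} → Set
    Level k = S k × v k ≡ v j
    level? : Decidable Level
    level? k = S? k ×-dec (v k ≟ v j)
    minimum≡1 : v j ≡ 1ℚ
    minimum≡1 with trap-meets-terminal level? (level-set-trap stable closed j-min) stop (Sj , refl)
    ... | w , (Sw , _) , inj₁ type≡term0 =
      contradiction (subst S (Equivalence.to (term0-iff w) type≡term0) Sw) ¬St0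
    ... | w , (_ , vw≡vj) , inj₂ type≡term1 = begin
      v j   ≡⟨ vw≡vj ⟨
      v w   ≡⟨ cong v (Equivalence.to (term1-iff w) type≡term1) ⟩
      v t1  ≡⟨ val-t1 ⟩
      1ℚ    ∎
      where open ≡-Reasoning

open import Data.Nat using (_+_; _*_; _≤_; z≤n)
open import Data.Nat.Properties
  using ( +-0-commutativeMonoid; ≤-antisym; ≤-refl; ≤-trans; ≤-reflexive; +-mono-≤; +-monoʳ-≤
        ; m≤m+n; m≤n+m; +-assoc; +-suc; *-identityʳ; m+1+n≰m; module ≤-Reasoning)
open import Data.Nat.Solver using (module +-*-Solver)
open import Data.Fin using (_≟_; punchIn)
open import Data.Fin.Properties using (punchInᵢ≢i)
open import Data.Vec.Functional using (removeAt)
open import Algebra.Properties.CommutativeMonoid.Sum +-0-commutativeMonoid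
  using (sum; sum-syntax; sum-remove; sum-cong-≗; sum-replicate-zero; ∑-distrib-+; ∑-comm)
open +-*-Solver using (solve; _:+_; _:*_; con; _:=_)

restrict : ∀ {a} {A : Set a} → Dec A → ℕ → ℕ
restrict (yes _) x = x
restrict (no _)  _ = 0

restrict-≤ : ∀ {a} {A : Set a} (d : Dec A) x → restrict d x ≤ x
restrict-≤ (yes _) _ = ≤-refl
restrict-≤ (no _)  _ = z≤n

restrict-yes : ∀ {a} {A : Set a} (d : Dec A) {x} → A → restrict d x ≡ x
restrict-yes (yes _) _ = refl
restrict-yes (no ¬a) a = contradiction a ¬a

restrict-no : ∀ {a} {A : Set a} (d : Dec A) {x} → ¬ A → restrict d x ≡ 0
restrict-no (yes a) ¬a = contradiction a ¬a
restrict-no (no _)  _  = refl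

restrict-mono : ∀ {a b} {A : Set a} {B : Set b} (dA : Dec A) (dB : Dec B) {x} →
                (A → B) → restrict dA x ≤ restrict dB x
restrict-mono (yes a) dB A⇒B = ≤-reflexive (sym (restrict-yes dB (A⇒B a)))
restrict-mono (no _)  dB A⇒B = z≤n

∑-mono : ∀ {n} {f g : Fin n → ℕ} → (∀ j → f j ≤ g j) → ∑[ j < n ] f j ≤ ∑[ j < n ] g j
∑-mono {zero}  f≤g = z≤n
∑-mono {suc n} f≤g = +-mono-≤ (f≤g _) (∑-mono (f≤g ∘ Fin.suc))

∑-const : ∀ n c → ∑[ j < n ] c ≡ n * c
∑-const zero    c = refl
∑-const (suc n) c = cong (c +_) (∑-const n c)

∑-zero : ∀ {n} {f : Fin n → ℕ} → (∀ j → f j ≡ 0) → ∑[ j < n ] f j ≡ 0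
∑-zero {n} f≡0 = trans (sum-cong-≗ f≡0) (sum-replicate-zero n)

∑-restrict-⊂ : ∀ {n p q} {P : Pred (Fin n) p} {Q : Pred (Fin n) q}
               (P? : Decidable P) (Q? : Decidable Q) (w : Fin n → ℕ) → P ⊆ Q →
               ∀ {u} → ¬ P u → Q u →
               w u + ∑[ j < n ] restrict (P? j) (w j) ≤ ∑[ j < n ] restrict (Q? j) (w j)
∑-restrict-⊂ {suc n} P? Q? w P⊆Q {u} ¬Pu Qu = begin
  w u + sum wP
    ≡⟨ cong (w u +_) (sum-remove {i = u} wP) ⟩
  w u + (wP u + sum (removeAt wP u))
    ≡⟨ cong (λ z → w u + (z + sum (removeAt wP u))) (restrict-no (P? u) ¬Pu) ⟩
  w u + sum (removeAt wP u)
    ≤⟨ +-monoʳ-≤ (w u) (∑-mono {n} (λ j → restrict-mono (P? _) (Q? _) P⊆Q)) ⟩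
  w u + sum (removeAt wQ u)
    ≡⟨ cong (_+ sum (removeAt wQ u)) (restrict-yes (Q? u) Qu) ⟨
  wQ u + sum (removeAt wQ u)
    ≡⟨ sum-remove wQ ⟨
  sum wQ
    ∎
  where
  open ≤-Reasoning
  wP wQ : Fin (suc n) → ℕ
  wP j = restrict (P? j) (w j)
  wQ j = restrict (Q? j) (w j)

∑-restrict-≥ : ∀ {n q} {Q : Pred (Fin n) q} (Q? : Decidable Q) (w : Fin n → ℕ) →
               ∀ {u} → Q u → w u ≤ ∑[ j < n ] restrict (Q? j) (w j)
∑-restrict-≥ {suc n} Q? w {u} Qu = begin
  w u                                 ≡⟨ restrict-yes (Q? u) Qu ⟨
  wQ u                                ≤⟨ m≤m+n _ _ ⟩
  wQ u + sum (removeAt wQ u)          ≡⟨ sum-remove wQ ⟨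
  sum wQ                              ∎
  where
  open ≤-Reasoning
  wQ : Fin (suc n) → ℕ
  wQ j = restrict (Q? j) (w j)

∑-restrict-≟ : ∀ {n} (a : Fin n) → ∑[ j < n ] restrict (a ≟ j) 1 ≡ 1
∑-restrict-≟ {suc n} a = begin
  sum δ                     ≡⟨ sum-remove {i = a} δ ⟩
  δ a + sum (removeAt δ a)  ≡⟨ cong₂ _+_ (restrict-yes (a ≟ a) refl) (∑-zero off-diagonal) ⟩
  1                         ∎
  where
  open ≡-Reasoning
  δ : Fin (suc n) → ℕ
  δ j = restrict (a ≟ j) 1
  off-diagonal : ∀ j → δ (punchIn a j) ≡ 0
  off-diagonal j = restrict-no (a ≟ punchIn a j) (punchInᵢ≢i a j ∘ sym)

module _ {n : ℕ} where
  open DecMembership (_≟_ {n}) using (_∈?_)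

  length≡∑-∈ : {xs : List (Fin n)} → Unique xs → length xs ≡ ∑[ j < n ] restrict (j ∈? xs) 1
  length≡∑-∈ {[]}     []           = sym (∑-zero {n} (λ j → restrict-no (j ∈? []) {1} λ ()))
  length≡∑-∈ {x ∷ xs} (x∉xs ∷ !xs) = begin
    suc (length xs)
      ≡⟨ cong suc (length≡∑-∈ !xs) ⟩
    1 + ∑[ j < n ] restrict (j ∈? xs) 1
      ≡⟨ cong (_+ _) (∑-restrict-≟ x) ⟨
    ∑[ j < n ] restrict (x ≟ j) 1 + ∑[ j < n ] restrict (j ∈? xs) 1
      ≡⟨ ∑-distrib-+ (λ j → restrict (x ≟ j) 1) (λ j → restrict (j ∈? xs) 1) ⟨
    ∑[ j < n ] (restrict (x ≟ j) 1 + restrict (j ∈? xs) 1)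
      ≡⟨ sum-cong-≗ split ⟨
    ∑[ j < n ] restrict (j ∈? x ∷ xs) 1
      ∎
    where
    open ≡-Reasoning
    split : ∀ j → restrict (j ∈? x ∷ xs) 1 ≡ restrict (x ≟ j) 1 + restrict (j ∈? xs) 1
    split j with x ≟ j
    ... | yes refl =
      trans (restrict-yes _ (here refl)) (cong suc (sym (restrict-no (j ∈? xs) (All¬⇒¬Any x∉xs))))
    ... | no x≢j   =
      ≤-antisym (restrict-mono (j ∈? x ∷ xs) (j ∈? xs) in-tail) (restrict-mono (j ∈? xs) (j ∈? x ∷ xs) there)
      where
      in-tail : j ∈ x ∷ xs → j ∈ xs
      in-tail (here j≡x)   = contradiction (sym j≡x) x≢j
      in-tail (there j∈xs) = j∈xs

  ∑-length-≤ : ∀ {k} (ps : Fin k → List (Fin n)) (c₁ c₂ : Fin n → Fin k) →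
               (∀ u → Unique (ps u)) → (∀ {u p} → p ∈ ps u → c₁ p ≡ u ⊎ c₂ p ≡ u) →
               ∑[ u < k ] length (ps u) ≤ n * 2
  ∑-length-≤ {k} ps c₁ c₂ unique p∈ps⇒child = begin
    ∑[ u < k ] length (ps u)
      ≡⟨ sum-cong-≗ (λ u → length≡∑-∈ (unique u)) ⟩
    ∑[ u < k ] ∑[ p < n ] restrict (p ∈? ps u) 1
      ≡⟨ ∑-comm (λ u p → restrict (p ∈? ps u) 1) ⟩
    ∑[ p < n ] ∑[ u < k ] restrict (p ∈? ps u) 1
      ≤⟨ ∑-mono {n} (λ p → ∑-mono {k} (occurrence p)) ⟩
    ∑[ p < n ] ∑[ u < k ] (restrict (c₁ p ≟ u) 1 + restrict (c₂ p ≟ u) 1)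
      ≡⟨ sum-cong-≗ (λ p → ∑-distrib-+ (λ u → restrict (c₁ p ≟ u) 1) _) ⟩
    ∑[ p < n ] (∑[ u < k ] restrict (c₁ p ≟ u) 1 + ∑[ u < k ] restrict (c₂ p ≟ u) 1)
      ≡⟨ sum-cong-≗ (λ p → cong₂ _+_ (∑-restrict-≟ (c₁ p)) (∑-restrict-≟ (c₂ p))) ⟩
    ∑[ p < n ] 2
      ≡⟨ ∑-const n 2 ⟩
    n * 2
      ∎
    where
    open ≤-Reasoning
    occurrence : ∀ p u → restrict (p ∈? ps u) 1 ≤ restrict (c₁ p ≟ u) 1 + restrict (c₂ p ≟ u) 1
    occurrence p u with p ∈? ps u
    ... | no _    = z≤n
    ... | yes p∈ with p∈ps⇒child p∈
    ...   | inj₁ c₁p≡u = ≤-trans (≤-reflexive (sym (restrict-yes (c₁ p ≟ u) c₁p≡u))) (m≤m+n _ _)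
    ...   | inj₂ c₂p≡u = ≤-trans (≤-reflexive (sym (restrict-yes (c₂ p ≟ u) c₂p≡u))) (m≤n+m _ _)

foldl-preserves : ∀ {a b p} {A : Set a} {B : Set b} (P : A → Set p) (f : A → B → A) xs →
                  (∀ {a x} → x ∈ xs → P a → P (f a x)) → ∀ {a} → P a → P (foldl f a xs)
foldl-preserves P f []       pres Pa = Pa
foldl-preserves P f (x ∷ xs) pres Pa = foldl-preserves P f xs (pres ∘ there) (pres (here refl) Pa)

module _ {m : ℕ} (bv : Node {m} → Bool) (p : Node {m}) where

  setFalse-self : setFalse bv p p ≡ false
  setFalse-self with p ≟ p
  ... | yes _  = refl
  ... | no p≢p = contradiction refl p≢p

  setFalse-marked : ∀ {j} → setFalse bv p j ≡ true → bv j ≡ true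
  setFalse-marked {j} marked with j ≟ p
  ... | no _ = marked

module _ {m : ℕ} (G : SSG m) where
  open SSG G

  n : ℕ
  n = suc (suc m)

  open DecMembership (_≟_ {n}) using (_∈?_)

  Config : Set
  Config = List (Node {m}) × (Node {m} → Bool)

  Marked : (Node {m} → Bool) → Node {m} → Set
  Marked bv j = bv j ≡ true

  Live : Config → Node {m} → Set
  Live (q , bv) j = Marked bv j ⊎ j ∈ q

  live? : ∀ st → Decidable (Live st)
  live? (q , bv) j = (bv j Bool.≟ true) ⊎-dec (j ∈? q)

  Consistent : Config → Set
  Consistent (q , bv) = (∀ {x} → x ∈ q → bv x ≡ false) × Unique q

  Sound : (Node {m} → ℚ) → (Node {m} → Bool) → Set
  Sound v bv = (λ j → v j ≡ 1ℚ) ⊆ Marked bv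

  Unmarks : NodeType → (Node {m} → Bool) → Node {m} → Set
  Unmarks maxN  bv p = bv (child₁ p) ≡ false × bv (child₂ p) ≡ false
  Unmarks minN  bv p = ⊤
  Unmarks avgN  bv p = ⊤
  Unmarks term0 bv p = ⊥
  Unmarks term1 bv p = ⊥

  unmarks⇒¬closed : ∀ t {bv p u} → Unmarks t bv p → child₁ p ≡ u ⊎ child₂ p ≡ u → ¬ Marked bv u →
                    ¬ Closed G t (Marked bv) p
  unmarks⇒¬closed maxN (unmarked₁ , _) _ _ (inj₁ marked₁) = not-¬ marked₁ unmarked₁
  unmarks⇒¬closed maxN (_ , unmarked₂) _ _ (inj₂ marked₂) = not-¬ marked₂ unmarked₂
  unmarks⇒¬closed minN _ (inj₁ refl) ¬marked (marked , _) = ¬marked marked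
  unmarks⇒¬closed minN _ (inj₂ refl) ¬marked (_ , marked) = ¬marked marked
  unmarks⇒¬closed avgN _ (inj₁ refl) ¬marked (marked , _) = ¬marked marked
  unmarks⇒¬closed avgN _ (inj₂ refl) ¬marked (_ , marked) = ¬marked marked

  data ParentUpdate : Config → Node {m} → Config → Set where
    skip   : ∀ {q bv p} → bv p ≡ false → ParentUpdate (q , bv) p (q , bv)
    keep   : ∀ {q bv p} → bv p ≡ true → Closed G (type p) (Marked bv) p →
             ParentUpdate (q , bv) p (q , bv)
    unmark : ∀ {q bv p} → bv p ≡ true → Unmarks (type p) bv p →
             ParentUpdate (q , bv) p (q ++ [ p ] , setFalse bv p)

  parentUpdate : ∀ st p → ParentUpdate st p (processParent G st p)
  parentUpdate (q , bv) p with bv p in marked | type p in type≡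
  ... | false | _     = skip marked
  ... | true  | minN  = unmark marked (subst (λ t → Unmarks t bv p) (sym type≡) tt)
  ... | true  | avgN  = unmark marked (subst (λ t → Unmarks t bv p) (sym type≡) tt)
  ... | true  | term0 = keep marked (subst (λ t → Closed G t (Marked bv) p) (sym type≡) tt)
  ... | true  | term1 = keep marked (subst (λ t → Closed G t (Marked bv) p) (sym type≡) tt)
  ... | true  | maxN with bv (child₁ p) in marked₁ | bv (child₂ p) in marked₂
  ...   | true  | _     = keep marked (subst (λ t → Closed G t (Marked bv) p) (sym type≡) (inj₁ marked₁))
  ...   | false | true  = keep marked (subst (λ t → Closed G t (Marked bv) p) (sym type≡) (inj₂ marked₂))
  ...   | false | false = unmark marked (subst (λ t → Unmarks t bv p) (sym type≡) (marked₁ , marked₂))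

  update-marked : ∀ {st p r} → ParentUpdate st p r → Marked (proj₂ r) ⊆ Marked (proj₂ st)
  update-marked (skip _)                   = id
  update-marked (keep _ _)                 = id
  update-marked (unmark {bv = bv} {p} _ _) = setFalse-marked bv p

  update-live : ∀ {st p r} → ParentUpdate st p r → Live r ≐ Live st
  update-live (skip _)   = id , id
  update-live (keep _ _) = id , id
  update-live (unmark {q} {bv} {p} marked _) = shrink , grow
    where
    shrink : Live (q ++ [ p ] , setFalse bv p) ⊆ Live (q , bv)
    shrink (inj₁ marked′) = inj₁ (setFalse-marked bv p marked′)
    shrink (inj₂ j∈q++p) with ∈-++⁻ q j∈q++p
    ... | inj₁ j∈q         = inj₂ j∈q
    ... | inj₂ (here refl) = inj₁ marked
    grow : Live (q , bv) ⊆ Live (q ++ [ p ] , setFalse bv p)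
    grow {j} (inj₁ marked′) with j ≟ p
    ... | yes refl = inj₂ (∈-++⁺ʳ q (here refl))
    ... | no _     = inj₁ marked′
    grow (inj₂ j∈q) = inj₂ (∈-++⁺ˡ j∈q)

  update-consistent : ∀ {st p r} → ParentUpdate st p r → Consistent st → Consistent r
  update-consistent (skip _)   = id
  update-consistent (keep _ _) = id
  update-consistent (unmark {q} {bv} {p} marked _) (unmarked , unique) =
    queued-unmarked , ++⁺ unique ([] ∷ []) λ where
      (p∈q , here refl) → not-¬ marked (unmarked p∈q)
    where
    queued-unmarked : ∀ {x} → x ∈ q ++ [ p ] → setFalse bv p x ≡ false
    queued-unmarked {x} x∈ with ∈-++⁻ q x∈
    ... | inj₂ (here refl) = setFalse-self bv p
    ... | inj₁ x∈q with x ≟ p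
    ...   | yes _ = refl
    ...   | no _  = unmarked x∈q

  update-closes-parent : ∀ {st p r} → ParentUpdate st p r →
                         Marked (proj₂ r) p → Closed G (type p) (Live r) p
  update-closes-parent (skip unmarked)            marked = contradiction unmarked (not-¬ marked)
  update-closes-parent (keep {p = p} _ closed)    _      = Closed-mono G (type p) (λ _ _ → inj₁) closed
  update-closes-parent (unmark {bv = bv} {p} _ _) marked =
    contradiction (setFalse-self bv p) (not-¬ marked)

  update-sound : ∀ {v} → Stable G v → ∀ {st p r u} → ParentUpdate st p r →
                 child₁ p ≡ u ⊎ child₂ p ≡ u → ¬ Marked (proj₂ st) u →
                 Sound v (proj₂ st) → Sound v (proj₂ r)
  update-sound _ (skip _)   _ _ sound = sound
  update-sound _ (keep _ _) _ _ sound = sound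
  update-sound stable (unmark {bv = bv} {p} _ unmarks) u-child u-unmarked sound {j} vj≡1 with j ≟ p
  ... | no _     = sound vj≡1
  ... | yes refl = contradiction
    (Closed-mono G (type p) (λ _ _ → sound) (one-valued-closed G stable vj≡1))
    (unmarks⇒¬closed (type p) unmarks u-child u-unmarked)

  process : Config → List (Node {m}) → Config
  process = foldl (processParent G)

  process-marked : ∀ st ps → Marked (proj₂ (process st ps)) ⊆ Marked (proj₂ st)
  process-marked st ps =
    foldl-preserves (λ r → Marked (proj₂ r) ⊆ Marked (proj₂ st)) (processParent G) ps
      (λ {r} {p} _ r⊆st → r⊆st ∘ update-marked (parentUpdate r p)) id

  process-live : ∀ st ps → Live (process st ps) ≐ Live st
  process-live st ps = foldl-preserves (λ r → Live r ≐ Live st) (processParent G) ps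
    (λ {r} {p} _ (r⊆st , st⊆r) →
      let r′⊆r , r⊆r′ = update-live (parentUpdate r p) in r⊆st ∘ r′⊆r , r⊆r′ ∘ st⊆r)
    (id , id)

  process-consistent : ∀ st ps → Consistent st → Consistent (process st ps)
  process-consistent st ps = foldl-preserves Consistent (processParent G) ps
    (λ {r} {p} _ → update-consistent (parentUpdate r p))

  process-sound : ∀ {v} → Stable G v → ∀ {u} st ps → (∀ {p} → p ∈ ps → child₁ p ≡ u ⊎ child₂ p ≡ u) →
                  ¬ Marked (proj₂ st) u → Sound v (proj₂ st) → Sound v (proj₂ (process st ps))
  process-sound {v} stable {u} st ps u-child u-unmarked sound = proj₂ (foldl-preserves
    (λ r → ¬ Marked (proj₂ r) u × Sound v (proj₂ r)) (processParent G) ps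
    (λ {r} {p} p∈ps (u-unmarked , sound) →
      let update = parentUpdate r p in
      u-unmarked ∘ update-marked update , update-sound stable update (u-child p∈ps) u-unmarked sound)
    (u-unmarked , sound))

  process-closes-parent : ∀ st ps {p} → p ∈ ps → Marked (proj₂ (process st ps)) p →
                          Closed G (type p) (Live (process st ps)) p
  process-closes-parent st (p ∷ ps) (here refl) marked =
    Closed-mono G (type p) (λ _ _ → proj₂ (process-live (processParent G st p) ps))
      (update-closes-parent (parentUpdate st p) (process-marked (processParent G st p) ps marked))
  process-closes-parent st (p′ ∷ ps) (there p∈ps) =
    process-closes-parent (processParent G st p′) ps p∈ps

  config : AlgState {m} → Config
  config s = AlgState.queue s , AlgState.bv s

  record Invariant (s : AlgState {m}) : Set where
    field
      consistent    : Consistent (config s)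
      marked-closed : ∀ {p} → Marked (AlgState.bv s) p → Closed G (type p) (Live (config s)) p

  parent-child : WellFormed G → ∀ {u p} → p ∈ parents u → child₁ p ≡ u ⊎ child₂ p ≡ u
  parent-child wf {u} {p} p∈ = proj₂ (Equivalence.to (WellFormed.parents-correct wf u p) p∈)

  module Pop (wf : WellFormed G) {u q bv c} (inv : Invariant ⟨ u ∷ q , bv , c ⟩) where
    open WellFormed wf using (parents-correct)
    open Invariant inv

    after : Config
    after = process (q , bv) (parents u)

    u-unmarked : ¬ Marked bv u
    u-unmarked marked = not-¬ marked (proj₁ consistent (here refl))

    u∉q : u ∉ q
    u∉q with proj₂ consistent
    ... | u∉ ∷ _ = All¬⇒¬Any u∉

    rest-consistent : Consistent (q , bv)
    rest-consistent with proj₂ consistent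
    ... | _ ∷ unique = proj₁ consistent ∘ there , unique

    live-shrinks : Live after ⊆ Live (u ∷ q , bv)
    live-shrinks live with proj₁ (process-live (q , bv) (parents u)) live
    ... | inj₁ marked = inj₁ marked
    ... | inj₂ j∈q    = inj₂ (there j∈q)

    popped-dead : ¬ Live after u
    popped-dead live with proj₁ (process-live (q , bv) (parents u)) live
    ... | inj₁ marked = u-unmarked marked
    ... | inj₂ u∈q    = u∉q u∈q

    child-stays-live : ∀ {p} → p ∉ parents u → IsNonTerminal {m} (type p) →
                       ∀ {c} → child₁ p ≡ c ⊎ child₂ p ≡ c → Live (u ∷ q , bv) c → Live after c
    child-stays-live {p} p∉ nonterminal p→c (inj₂ (here refl)) =
      contradiction (Equivalence.from (parents-correct u p) (nonterminal , p→c)) p∉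
    child-stays-live _ _ _ (inj₁ marked)      = proj₂ (process-live (q , bv) (parents u)) (inj₁ marked)
    child-stays-live _ _ _ (inj₂ (there c∈q)) = proj₂ (process-live (q , bv) (parents u)) (inj₂ c∈q)

    invariant : Invariant (step G ⟨ u ∷ q , bv , c ⟩)
    invariant = record
      { consistent    = process-consistent (q , bv) (parents u) rest-consistent
      ; marked-closed = closed
      }
      where
      closed : ∀ {p} → Marked (proj₂ after) p → Closed G (type p) (Live after) p
      closed {p} marked with p ∈? parents u
      ... | yes p∈ = process-closes-parent (q , bv) (parents u) p∈ marked
      ... | no p∉  = Closed-mono G (type p) (child-stays-live p∉)
                       (marked-closed (process-marked (q , bv) (parents u) marked))

    sound : ∀ {v} → Stable G v → Sound v bv → Sound v (proj₂ after)
    sound stable = process-sound stable (q , bv) (parents u) (parent-child wf) u-unmarked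

  step-idle : ∀ s → AlgState.queue s ≡ [] → step G s ≡ s
  step-idle ⟨ [] , _ , _ ⟩ refl = refl

  step-marked : ∀ s → Marked (AlgState.bv (step G s)) ⊆ Marked (AlgState.bv s)
  step-marked ⟨ []    , _  , _ ⟩ = id
  step-marked ⟨ u ∷ q , bv , _ ⟩ = process-marked (q , bv) (parents u)

  step-invariant : WellFormed G → ∀ s → Invariant s → Invariant (step G s)
  step-invariant wf ⟨ []    , _ , _ ⟩ inv = inv
  step-invariant wf ⟨ _ ∷ _ , _ , _ ⟩ inv = Pop.invariant wf inv

  step-sound : WellFormed G → ∀ {v} → Stable G v → ∀ s → Invariant s →
               Sound v (AlgState.bv s) → Sound v (AlgState.bv (step G s))
  step-sound wf stable ⟨ []    , _ , _ ⟩ inv = id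
  step-sound wf stable ⟨ _ ∷ _ , _ , _ ⟩ inv = Pop.sound wf inv stable

  potential : (Node {m} → ℕ) → AlgState {m} → ℕ
  potential w s = ∑[ j < n ] restrict (live? (config s) j) (w j)

  potential-≤ : ∀ w s → potential w s ≤ ∑[ j < n ] w j
  potential-≤ w s = ∑-mono {n} (λ j → restrict-≤ (live? (config s) j) (w j))

  step-potential : WellFormed G → ∀ w {s u q} → Invariant s → AlgState.queue s ≡ u ∷ q →
                   w u + potential w (step G s) ≤ potential w s
  step-potential wf w {⟨ u ∷ q , bv , c ⟩} inv refl =
    ∑-restrict-⊂ (live? after) (live? (u ∷ q , bv)) w live-shrinks popped-dead (inj₂ (here refl))
    where open Pop wf inv

  weight : Node {m} → ℕ
  weight u = suc (length (parents u))

  step-cost : WellFormed G → ∀ s → Invariant s →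
              AlgState.cost (step G s) + potential weight (step G s) ≤
              AlgState.cost s + potential weight s
  step-cost wf ⟨ []    , _  , _ ⟩ inv = ≤-refl
  step-cost wf ⟨ u ∷ q , bv , c ⟩ inv = begin
    c + weight u + potential weight s′    ≡⟨ +-assoc c (weight u) _ ⟩
    c + (weight u + potential weight s′)  ≤⟨ +-monoʳ-≤ c (step-potential wf weight inv refl) ⟩
    c + potential weight s                ∎
    where
    open ≤-Reasoning
    s s′ : AlgState {m}
    s  = ⟨ u ∷ q , bv , c ⟩
    s′ = step G s

  initial-live : Universal (Live (config initState))
  initial-live j with j ≟ t0
  ... | yes refl = inj₂ (here refl)
  ... | no _     = inj₁ refl

  initial-t0-unmarked : ¬ Marked (AlgState.bv initState) t0
  initial-t0-unmarked with t0 {m} ≟ t0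
  ... | yes _    = λ ()
  ... | no t0≢t0 = contradiction refl t0≢t0

  initial-invariant : Invariant initState
  initial-invariant = record
    { consistent    = (λ { (here refl) → ¬-not initial-t0-unmarked }) , ([] ∷ [])
    ; marked-closed = λ {p} _ → Closed-universal G (type p) initial-live
    }

  initial-sound : ∀ {v} → Stable G v → Sound v (AlgState.bv initState)
  initial-sound stable {j} vj≡1 with j ≟ t0
  ... | yes refl = contradiction (trans (sym (Stable.val-t0 stable)) vj≡1) λ ()
  ... | no _     = refl

  module Run (wf : WellFormed G) where

    iter-invariant : ∀ k → Invariant (iterateSteps G k)
    iter-invariant zero    = initial-invariant
    iter-invariant (suc k) = step-invariant wf _ (iter-invariant k)

    iter-t0-unmarked : ∀ k → ¬ Marked (AlgState.bv (iterateSteps G k)) t0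
    iter-t0-unmarked zero    = initial-t0-unmarked
    iter-t0-unmarked (suc k) = iter-t0-unmarked k ∘ step-marked (iterateSteps G k)

    iter-sound : ∀ {v} → Stable G v → ∀ k → Sound v (AlgState.bv (iterateSteps G k))
    iter-sound stable zero    = initial-sound stable
    iter-sound stable (suc k) = step-sound wf stable _ (iter-invariant k) (iter-sound stable k)

    iter-cost : ∀ k → AlgState.cost (iterateSteps G k) + potential weight (iterateSteps G k) ≤
                      n + ∑[ u < n ] weight u
    iter-cost zero    = +-monoʳ-≤ n (potential-≤ weight initState)
    iter-cost (suc k) = ≤-trans (step-cost wf _ (iter-invariant k)) (iter-cost k)

    busy-bound : ∀ k {u q} → AlgState.queue (iterateSteps G k) ≡ u ∷ q →
                 k + potential (const 1) (iterateSteps G k) ≤ n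
    busy-bound zero _ = begin
      potential (const 1) initState  ≤⟨ potential-≤ (const 1) initState ⟩
      ∑[ j < n ] 1                   ≡⟨ ∑-const n 1 ⟩
      n * 1                          ≡⟨ *-identityʳ n ⟩
      n                              ∎
      where open ≤-Reasoning
    busy-bound (suc k) busy with AlgState.queue (iterateSteps G k) in busy′
    ... | [] with () ← trans (sym busy′) (trans (sym (cong AlgState.queue (step-idle _ busy′))) busy)
    ... | _ ∷ _ = begin
      suc k + potential (const 1) s′
        ≡⟨ +-suc k _ ⟨
      k + suc (potential (const 1) s′)
        ≤⟨ +-monoʳ-≤ k (step-potential wf (const 1) (iter-invariant k) busy′) ⟩
      k + potential (const 1) s
        ≤⟨ busy-bound k busy′ ⟩
      n
        ∎
      where
      open ≤-Reasoning
      s s′ : AlgState {m}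
      s  = iterateSteps G k
      s′ = step G s

    queue-empty : AlgState.queue (iterateSteps G n) ≡ []
    queue-empty with AlgState.queue (iterateSteps G n) in busy
    ... | []    = refl
    ... | u ∷ _ = contradiction (≤-trans (+-monoʳ-≤ n some-live) (busy-bound n busy)) (m+1+n≰m n)
      where
      some-live : 1 ≤ potential (const 1) (iterateSteps G n)
      some-live = ∑-restrict-≥ (live? (config (iterateSteps G n))) (const 1)
                    (inj₂ (subst (u ∈_) (sym busy) (here refl)))

    cost-≤ : AlgState.cost (iterateSteps G n) ≤ 4 * n
    cost-≤ = begin
      AlgState.cost s
        ≤⟨ m≤m+n _ _ ⟩
      AlgState.cost s + potential weight s
        ≤⟨ iter-cost n ⟩
      n + ∑[ u < n ] weight u
        ≡⟨ cong (n +_) (∑-distrib-+ (const 1) (length ∘ parents)) ⟩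
      n + (∑[ u < n ] 1 + ∑[ u < n ] length (parents u))
        ≤⟨ +-monoʳ-≤ n (+-mono-≤ (≤-reflexive (∑-const n 1)) parents≤) ⟩
      n + (n * 1 + n * 2)
        ≡⟨ solve 1 (λ x → x :+ (x :* con 1 :+ x :* con 2) := con 4 :* x) refl n ⟩
      4 * n
        ∎
      where
      open ≤-Reasoning
      s : AlgState {m}
      s = iterateSteps G n
      parents≤ : ∑[ u < n ] length (parents u) ≤ n * 2
      parents≤ = ∑-length-≤ parents child₁ child₂ (WellFormed.parents-unique wf) (parent-child wf)

    marked⇔one-valued : StoppingGame G → ∀ {v} → Stable G v →
                        ∀ i → Marked (AlgState.bv (iterateSteps G n)) i ⇔ v i ≡ 1ℚ
    marked⇔one-valued stop stable i =
      mk⇔ (closed⇒one-valued G wf stop stable (λ j → bv j Bool.≟ true) closed (iter-t0-unmarked n))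
          (iter-sound stable n)
      where
      bv : Node {m} → Bool
      bv = AlgState.bv (iterateSteps G n)
      live⇒marked : Live (config (iterateSteps G n)) ⊆ Marked bv
      live⇒marked (inj₁ marked)  = marked
      live⇒marked (inj₂ j∈queue) with () ← subst (_ ∈_) queue-empty j∈queue
      closed : IsClosed G (Marked bv)
      closed marked =
        Closed-mono G _ (λ _ _ → live⇒marked) (Invariant.marked-closed (iter-invariant n) marked)

mainTheorem6 : Σ ℕ λ c → ∀ (m : ℕ) (G : SSG m) → WellFormed G → StoppingGame G →
    Σ ℕ λ k →
      (AlgState.queue (iterateSteps G k) ≡ [])
      × (AlgState.cost (iterateSteps G k) ≤ c * suc (suc m))
      × (∀ (v : Fin (suc (suc m)) → ℚ) → Stable G v →
           ∀ i → (AlgState.bv (iterateSteps G k) i ≡ true) ⇔ (v i ≡ 1ℚ))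
mainTheorem6 = 4 , λ m G wf stop →
  let open Run G wf in
  n G , queue-empty , cost-≤ , λ v stable → marked⇔one-valued stop stable
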